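{- For every integer $n\ge 0$, $$F_n(112;q,r,s,1)=F_n(122;q,s,r,1).$$
   Context: A restricted growth function (RGF) of length $n$ is a sequence $w=w_1\dots w_n$ of positive integers with $w_1=1$ and $w_i\le 1+\max\{w_1,\dots,w_{i-1}\}$ for $i\ge 2$ ($R_0$ consists of the empty word); $R_n$ is the set of RGFs of length $n$. The standardization of a word replaces every occurrence of its smallest letter by $1$, of its next smallest letter by $2$, and so on. An RGF $w$ contains an RGF $v$ if some subword (subsequence, not necessarily consecutive) of $w$ standardizes to $v$; otherwise $w$ avoids $v$. $R_n(v)$ is the set of $w\in R_n$ avoiding $v$. For a word $w$ and position $j$: $\mathrm{lb}(w_j)$ (resp. $\mathrm{ls}(w_j)$) is the number of distinct values $w_i$ with $i<j$ and $w_i>w_j$ (resp. $w_i<w_j$); $\mathrm{rb}(w_j)$ (resp. $\mathrm{rs}(w_j)$) is the number of distinct values $w_i$ with $i>j$ and $w_i>w_j$ (resp. $w_i<w_j$); each statistic of $w$ is the sum over $j$. Then $F_n(v;q,r,s,t)=\sum_{w\in R_n(v)}q^{\mathrm{lb}(w)}r^{\mathrm{ls}(w)}s^{\mathrm{rb}(w)}t^{\mathrm{rs}(w)}$. -}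

module Defs where

open import Level using (Level)
open import Data.Bool using (Bool; true; false; _∧_; not; if_then_else_)
open import Data.Nat using (ℕ; zero; suc; _⊔_; _<ᵇ_; _≡ᵇ_; _≤ᵇ_)
open import Data.Nat.Properties using (_≟_)
open import Data.List using (List; []; _∷_; map; concatMap; length; upTo; deduplicate; filterᵇ)
open import Data.Bool.ListAction using (any)
open import Data.List.Properties using (≡-dec)
open import Relation.Nullary using (does)
open import Algebra.Bundles using (CommutativeSemiring)

Word : Set
Word = List ℕ

-- rgfCheck m w : every letter x of w satisfies 1 ≤ x ≤ 1 + (max of the
-- letters before it), where m is the maximum of the letters already read
-- (m = 0 initially, so the first letter is forced to be 1).
rgfCheck : ℕ → Word → Bool
rgfCheck m [] = true
rgfCheck m (x ∷ xs) = (1 ≤ᵇ x) ∧ (x ≤ᵇ suc m) ∧ rgfCheck (m ⊔ x) xs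

isRGF : Word → Bool
isRGF = rgfCheck 0

words : ℕ → ℕ → List Word
words zero    k = [] ∷ []
words (suc n) k = concatMap (λ x → map (x ∷_) (words n k)) (map suc (upTo k))

-- R n : all RGFs of length n (every RGF of length n has letters in {1,…,n})
R : ℕ → List Word
R n = filterᵇ isRGF (words n n)

distinctCount : (ℕ → Bool) → Word → ℕ
distinctCount p xs = length (deduplicate _≟_ (filterᵇ p xs))

standardize : Word → Word
standardize u = map (λ x → suc (distinctCount (λ y → y <ᵇ x) u)) u

subwords : Word → List Word
subwords [] = [] ∷ []
subwords (x ∷ xs) = map (x ∷_) (subwords xs) Data.List.++ subwords xs

contains : Word → Word → Bool
contains w v = any (λ u → does (≡-dec _≟_ (standardize u) v)) (subwords w)

avoids : Word → Word → Bool
avoids w v = not (contains w v)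

Rav : ℕ → Word → List Word
Rav n v = filterᵇ (λ w → avoids w v) (R n)

-- position statistics, summed over positions j; `pre` holds w_1 … w_{j-1}
statGo : (Word → ℕ → Word → ℕ) → Word → Word → ℕ
statGo f pre [] = 0
statGo f pre (x ∷ xs) = f pre x xs Data.Nat.+ statGo f (x ∷ pre) xs

lb ls rb rs : Word → ℕ
lb = statGo (λ pre x post → distinctCount (λ y → x <ᵇ y) pre) []
ls = statGo (λ pre x post → distinctCount (λ y → y <ᵇ x) pre) []
rb = statGo (λ pre x post → distinctCount (λ y → x <ᵇ y) post) []
rs = statGo (λ pre x post → distinctCount (λ y → y <ᵇ x) post) []

-- The generating function F_n(v; q, r, s, t), evaluated in an arbitrary
-- commutative semiring (so identities for all semirings = polynomial identities).
module _ {c ℓ : Level} (S : CommutativeSemiring c ℓ) where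
  open CommutativeSemiring S

  pow : Carrier → ℕ → Carrier
  pow x zero = 1#
  pow x (suc n) = x * pow x n

  sumC : List Carrier → Carrier
  sumC [] = 0#
  sumC (x ∷ xs) = x + sumC xs

  F : ℕ → Word → Carrier → Carrier → Carrier → Carrier → Carrier
  F n v q r s t =
    sumC (map (λ w → pow q (lb w) * pow r (ls w) * pow s (rb w) * pow t (rs w)) (Rav n v))

module Submission where

-- A 112-avoiding RGF of length n + 1 is an increasing run 1, 2, …, m + 1 followed by a
-- weakly decreasing word, and a 122-avoiding RGF is a 1 followed by letters each equal to
-- 1 or to a new maximum.  Both kinds are encoded by the words over {old, new} of length n:
-- in the first, `new` lowers the current letter of the decreasing tail by one and `old`
-- repeats it (so that m is the number of `new` steps); in the second, `new` writes a new
-- maximum and `old` writes 1.  For both avoiders of a code, lb is the number of pairs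
-- (`new`, later `old`).  The rb of the 112-avoider equals the ls of the 122-avoider, namely
-- 1 + ⋯ + m; the ls of the 112-avoider equals the rb of the 122-avoider, namely 1 + ⋯ + m
-- plus the number of pairs (`old`, later `new`).  The bijection does not control rs, which
-- is why the last variable is 1.

open import Defs
open import Level using (Level)
open import Algebra.Bundles using (CommutativeSemiring; CommutativeMonoid)
import Algebra.Properties.CommutativeSemigroup as CommutativeSemigroupProperties
open import Data.Bool using (Bool; true; false; T)
open import Data.Bool.Properties using (T-∧)
open import Data.Empty using (⊥; ⊥-elim)
open import Data.Unit using (⊤)
open import Data.Nat using (ℕ; zero; suc; pred; _+_; _≤_; _<_; _⊔_; _<ᵇ_; z≤n; s≤s; s≤s⁻¹; z<s)
open import Data.Nat.Properties
open CommutativeSemigroupProperties +-commutativeSemigroup using (x∙yz≈y∙xz)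
open import Data.List
  using ( List; []; _∷_; _++_; _ʳ++_; [_]; map; length; filterᵇ; deduplicate; concatMap; upTo; replicate
        ; cartesianProductWith)
open import Data.List.Properties
  using (map-∘; filter-none; ∷-injective; ∷-injectiveˡ; ∷-injectiveʳ; ++-assoc; ++-cancelˡ; length-++; ≡-dec)
open import Data.List.Membership.Propositional using (_∈_; lose; find)
open import Data.List.Membership.Propositional.Properties
open import Data.List.Membership.Propositional.Properties.WithK using (unique∧set⇒bag)
open import Data.List.Relation.Unary.Any using (here; there)
open import Data.List.Relation.Unary.Any.Properties using (any⁺; any⁻)
open import Data.List.Relation.Unary.All as All using (All)
open import Data.List.Relation.Unary.AllPairs as AllPairs using ()
open import Data.List.Relation.Unary.Unique.Propositional using (Unique)
import Data.List.Relation.Unary.Unique.Propositional.Properties as Unique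
open import Data.List.Relation.Unary.Unique.DecPropositional.Properties using (deduplicate-!)
open import Data.List.Relation.Binary.BagAndSetEquality using (∼bag⇒↭)
open import Data.List.Relation.Binary.Permutation.Propositional as Perm using (_↭_)
open import Data.List.Relation.Binary.Permutation.Propositional.Properties using (↭-length) renaming (map⁺ to ↭-map⁺)
open import Data.List.Relation.Binary.Sublist.Propositional
  using (_⊆_; []; _∷_; _∷ʳ_; minimum; from∈; to∈; ⊆-refl; ⊆-trans; lookup)
open import Data.List.Relation.Binary.Sublist.Propositional.Properties using (∷⁻) renaming (++⁺ to ⊆-++⁺)
open import Data.Product using (_×_; _,_; proj₁; proj₂; ∃-syntax)
open import Data.Sum using (_⊎_; inj₁; inj₂)
open import Function using (_∘_; _⇔_; mk⇔; Equivalence)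
open import Relation.Binary.PropositionalEquality
  using (_≡_; _≢_; refl; sym; trans; cong; cong₂; subst; module ≡-Reasoning)
open import Relation.Nullary using (¬_; yes; no)
open import Relation.Nullary.Decidable using (T?; dec-true)

-- Counting distinct values

interval : ℕ → ℕ → List ℕ
interval c zero    = []
interval c (suc j) = c ∷ interval (suc c) j

∈-interval⁻ : ∀ c j {z} → z ∈ interval c j → c ≤ z × z < c + j
∈-interval⁻ c (suc j) (here refl) = ≤-refl , m<m+n c z<s
∈-interval⁻ c (suc j) {z} (there z∈) with c<z , z<c+j ← ∈-interval⁻ (suc c) j z∈ =
  <⇒≤ c<z , subst (z <_) (sym (+-suc c j)) z<c+j

∈-interval⁺ : ∀ c j {z} → c ≤ z → z < c + j → z ∈ interval c j
∈-interval⁺ c zero    c≤z z<c+0 = ⊥-elim (<⇒≱ z<c+0 (subst (_≤ _) (sym (+-identityʳ c)) c≤z))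
∈-interval⁺ c (suc j) {z} c≤z z<c+j with c ≟ z
... | yes refl = here refl
... | no  c≢z  = there (∈-interval⁺ (suc c) j (≤∧≢⇒< c≤z c≢z) (subst (z <_) (+-suc c j) z<c+j))

interval-unique : ∀ c j → Unique (interval c j)
interval-unique c zero    = AllPairs.[]
interval-unique c (suc j) =
  All.tabulate (λ z∈ c≡z → <⇒≢ (proj₁ (∈-interval⁻ (suc c) j z∈)) c≡z)
  AllPairs.∷ interval-unique (suc c) j

length-interval : ∀ c j → length (interval c j) ≡ j
length-interval c zero    = refl
length-interval c (suc j) = cong suc (length-interval (suc c) j)

interval-suc : ∀ c j → interval c (suc j) ≡ interval c j ++ [ c + j ]
interval-suc c zero    = cong [_] (sym (+-identityʳ c))
interval-suc c (suc j) =
  cong (c ∷_) (trans (interval-suc (suc c) j) (cong (λ x → interval (suc c) j ++ [ x ]) (sym (+-suc c j))))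

distinctValues : (ℕ → Bool) → Word → List ℕ
distinctValues p xs = deduplicate _≟_ (filterᵇ p xs)

∈-distinctValues⁻ : ∀ p xs {z} → z ∈ distinctValues p xs → z ∈ xs × T (p z)
∈-distinctValues⁻ p xs z∈ = ∈-filter⁻ (T? ∘ p) (∈-deduplicate⁻ _≟_ (filterᵇ p xs) z∈)

∈-distinctValues⁺ : ∀ p xs {z} → z ∈ xs → T (p z) → z ∈ distinctValues p xs
∈-distinctValues⁺ p xs z∈ pz = ∈-deduplicate⁺ _≟_ (∈-filter⁺ (T? ∘ p) z∈ pz)

distinctCount-none : ∀ p xs → (∀ {z} → z ∈ xs → ¬ T (p z)) → distinctCount p xs ≡ 0
distinctCount-none p xs none = cong (length ∘ deduplicate _≟_) (filter-none (T? ∘ p) (All.tabulate none))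

distinctCount-unique : ∀ p xs {ys} → Unique ys →
  (∀ {z} → z ∈ xs → T (p z) → z ∈ ys) → (∀ {z} → z ∈ ys → z ∈ xs × T (p z)) →
  distinctCount p xs ≡ length ys
distinctCount-unique p xs {ys} unique sound complete =
  ↭-length (∼bag⇒↭ (unique∧set⇒bag (deduplicate-! _≟_ (filterᵇ p xs)) unique (mk⇔ to from)))
  where
  to : ∀ {z} → z ∈ distinctValues p xs → z ∈ ys
  to z∈ = let z∈xs , pz = ∈-distinctValues⁻ p xs z∈ in sound z∈xs pz
  from : ∀ {z} → z ∈ ys → z ∈ distinctValues p xs
  from z∈ = let z∈xs , pz = complete z∈ in ∈-distinctValues⁺ p xs z∈xs pz

distinctCount-interval : ∀ p xs c j →
  (∀ {z} → z ∈ xs → T (p z) → c ≤ z × z < c + j) →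
  (∀ {z} → c ≤ z → z < c + j → z ∈ xs × T (p z)) →
  distinctCount p xs ≡ j
distinctCount-interval p xs c j sound complete = trans
  (distinctCount-unique p xs (interval-unique c j)
    (λ z∈ pz → let c≤z , z<c+j = sound z∈ pz in ∈-interval⁺ c j c≤z z<c+j)
    (λ z∈ → let c≤z , z<c+j = ∈-interval⁻ c j z∈ in complete c≤z z<c+j))
  (length-interval c j)

distinctCount-pos : ∀ p xs {z} → z ∈ xs → T (p z) → 0 < distinctCount p xs
distinctCount-pos p xs z∈ pz = ∈-length (∈-distinctValues⁺ p xs z∈ pz)

distinctCount-two : ∀ p xs {a b} → a ∈ xs → b ∈ xs → a ≢ b → T (p a) → T (p b) → 2 ≤ distinctCount p xs
distinctCount-two p xs {a} {b} a∈ b∈ a≢b pa pb =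
  two-members (∈-distinctValues⁺ p xs a∈ pa) (∈-distinctValues⁺ p xs b∈ pb)
  where
  two-members : ∀ {ys : List ℕ} → a ∈ ys → b ∈ ys → 2 ≤ length ys
  two-members (here refl) (here refl) = ⊥-elim (a≢b refl)
  two-members (here _)    (there b∈′) = s≤s (∈-length b∈′)
  two-members (there a∈′) (here _)    = s≤s (∈-length a∈′)
  two-members (there a∈′) (there b∈′) = m≤n⇒m≤1+n (two-members a∈′ b∈′)

distinctCount-some : ∀ p xs {k} → distinctCount p xs ≡ suc k → ∃[ z ] z ∈ xs × T (p z)
distinctCount-some p xs count with distinctValues p xs in eq
... | z ∷ _ = z , ∈-distinctValues⁻ p xs (subst (z ∈_) (sym eq) (here refl))

-- Standardization and pattern containment

below : Word → ℕ → ℕ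
below u v = distinctCount (_<ᵇ v) u

below-none⁺ : ∀ u {v} → (∀ {z} → z ∈ u → v ≤ z) → below u v ≡ 0
below-none⁺ u above = distinctCount-none _ u (λ z∈ z<v → ≤⇒≯ (above z∈) (<ᵇ⇒< _ _ z<v))

below-none⁻ : ∀ u {v a} → below u v ≡ 0 → a ∈ u → v ≤ a
below-none⁻ u none a∈ = ≮⇒≥ (λ a<v → <⇒≢ (distinctCount-pos _ u a∈ (<⇒<ᵇ a<v)) (sym none))

below-some⁻ : ∀ u {v k} → below u v ≡ suc k → ∃[ a ] a ∈ u × a < v
below-some⁻ u {v} count with a , a∈ , a<v ← distinctCount-some _ u count = a , a∈ , <ᵇ⇒< a v a<v

below-one⁺ : ∀ u {v a} → a ∈ u → a < v → (∀ {z} → z ∈ u → z < v → z ≡ a) → below u v ≡ 1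
below-one⁺ u a∈ a<v only = distinctCount-unique _ u (All.[] AllPairs.∷ AllPairs.[])
  (λ z∈ z<v → here (only z∈ (<ᵇ⇒< _ _ z<v)))
  (λ { (here refl) → a∈ , <⇒<ᵇ a<v })

below-one⁻ : ∀ u {v a b} → below u v ≡ 1 → a ∈ u → b ∈ u → a < v → b < v → a ≡ b
below-one⁻ u one a∈ b∈ a<v b<v with _ ≟ _
... | yes a≡b = a≡b
... | no  a≢b = ⊥-elim (<-irrefl (sym one) (distinctCount-two _ u a∈ b∈ a≢b (<⇒<ᵇ a<v) (<⇒<ᵇ b<v)))

standardize-aab : ∀ {a b} → a < b → standardize (a ∷ a ∷ b ∷ []) ≡ 1 ∷ 1 ∷ 2 ∷ []
standardize-aab {a} {b} a<b = cong₂ (λ i k → suc i ∷ suc i ∷ suc k ∷ []) below-a below-b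
  where
  u : Word
  u = a ∷ a ∷ b ∷ []
  below-a : below u a ≡ 0
  below-a = below-none⁺ u λ { (here refl) → ≤-refl
                            ; (there (here refl)) → ≤-refl
                            ; (there (there (here refl))) → <⇒≤ a<b }
  below-b : below u b ≡ 1
  below-b = below-one⁺ u (here refl) a<b
    λ { (here refl) _ → refl
      ; (there (here refl)) _ → refl
      ; (there (there (here refl))) b<b → ⊥-elim (<-irrefl refl b<b) }

standardize-abb : ∀ {a b} → a < b → standardize (a ∷ b ∷ b ∷ []) ≡ 1 ∷ 2 ∷ 2 ∷ []
standardize-abb {a} {b} a<b = cong₂ (λ i k → suc i ∷ suc k ∷ suc k ∷ []) below-a below-b
  where
  u : Word
  u = a ∷ b ∷ b ∷ []
  below-a : below u a ≡ 0
  below-a = below-none⁺ u λ { (here refl) → ≤-refl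
                            ; (there (here refl)) → <⇒≤ a<b
                            ; (there (there (here refl))) → <⇒≤ a<b }
  below-b : below u b ≡ 1
  below-b = below-one⁺ u (here refl) a<b
    λ { (here refl) _ → refl
      ; (there (here refl)) b<b → ⊥-elim (<-irrefl refl b<b)
      ; (there (there (here refl))) b<b → ⊥-elim (<-irrefl refl b<b) }

standardize-letters : ∀ x y z {i j k} → standardize (x ∷ y ∷ z ∷ []) ≡ suc i ∷ suc j ∷ suc k ∷ [] →
  let u = x ∷ y ∷ z ∷ [] in below u x ≡ i × below u y ≡ j × below u z ≡ k
standardize-letters x y z std with ∷-injective std
... | ex , std′ with ∷-injective std′
... | ey , std″ = suc-injective ex , suc-injective ey , suc-injective (∷-injectiveˡ std″)

standardize≡112 : ∀ u → standardize u ≡ 1 ∷ 1 ∷ 2 ∷ [] → ∃[ a ] ∃[ b ] a < b × u ≡ a ∷ a ∷ b ∷ []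
standardize≡112 u@(x ∷ y ∷ z ∷ []) std
  with below-x , below-y , below-z ← standardize-letters x y z std
  with refl ← ≤-antisym (below-none⁻ u below-x (there (here refl))) (below-none⁻ u below-y (here refl))
  with w , w∈ , w<z ← below-some⁻ u below-z =
  x , z , ≤-<-trans (below-none⁻ u below-x w∈) w<z , refl

standardize≡122 : ∀ u → standardize u ≡ 1 ∷ 2 ∷ 2 ∷ [] → ∃[ a ] ∃[ b ] a < b × u ≡ a ∷ b ∷ b ∷ []
standardize≡122 u@(x ∷ y ∷ z ∷ []) std
  with below-x , below-y , below-z ← standardize-letters x y z std =
  x , y , x<y , cong (λ c → x ∷ y ∷ c ∷ []) (sym y≡z)
  where
  above-x : ∀ {v} → v ∈ u → below u v ≡ 1 → x < v
  above-x v∈ one with w , w∈ , w<v ← below-some⁻ u one = ≤-<-trans (below-none⁻ u below-x w∈) w<v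
  x<y : x < y
  x<y = above-x (there (here refl)) below-y
  x<z : x < z
  x<z = above-x (there (there (here refl))) below-z
  y≡z : y ≡ z
  y≡z = ≤-antisym
    (≮⇒≥ λ z<y → <⇒≢ x<z (below-one⁻ u below-y (here refl) (there (there (here refl))) x<y z<y))
    (≮⇒≥ λ y<z → <⇒≢ x<y (below-one⁻ u below-z (here refl) (there (here refl)) x<z y<z))

∈-subwords⁻ : ∀ w {u} → u ∈ subwords w → u ⊆ w
∈-subwords⁻ []      (here refl) = []
∈-subwords⁻ (x ∷ w) u∈ with ∈-++⁻ (map (x ∷_) (subwords w)) u∈
... | inj₁ u∈kept with v , v∈ , refl ← ∈-map⁻ (x ∷_) u∈kept = refl ∷ ∈-subwords⁻ w v∈
... | inj₂ u∈skipping = x ∷ʳ ∈-subwords⁻ w u∈skipping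

∈-subwords⁺ : ∀ {u w} → u ⊆ w → u ∈ subwords w
∈-subwords⁺ []                         = here refl
∈-subwords⁺ {w = x ∷ w} (.x ∷ʳ u⊆w)    = ∈-++⁺ʳ (map (x ∷_) (subwords w)) (∈-subwords⁺ u⊆w)
∈-subwords⁺ {w = x ∷ w} (refl ∷ u⊆w)   = ∈-++⁺ˡ (∈-map⁺ (x ∷_) (∈-subwords⁺ u⊆w))

contains⁺ : ∀ {u w} v → u ⊆ w → standardize u ≡ v → T (contains w v)
contains⁺ v u⊆w std≡v = any⁺ _ (lose (∈-subwords⁺ u⊆w) (subst T (sym (dec-true (≡-dec _≟_ _ v) std≡v)) _))

contains⁻ : ∀ w v → T (contains w v) → ∃[ u ] u ⊆ w × standardize u ≡ v
contains⁻ w v c with u , u∈ , std≡v ← find (any⁻ _ (subwords w) c) with ≡-dec _≟_ (standardize u) v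
... | yes std≡v = u , ∈-subwords⁻ w u∈ , std≡v

avoids⁺ : ∀ w v → (∀ {u} → u ⊆ w → standardize u ≢ v) → T (avoids w v)
avoids⁺ w v free with contains w v in eq
... | false = _
... | true with _ , u⊆w , std≡v ← contains⁻ w v (subst T (sym eq) _) = free u⊆w std≡v

avoids⁻ : ∀ {u w} v → T (avoids w v) → u ⊆ w → standardize u ≢ v
avoids⁻ {w = w} v avoid u⊆w std≡v with contains w v | contains⁺ v u⊆w std≡v
... | true | _ = avoid

Avoids112 Avoids122 : Word → Set
Avoids112 w = ∀ {a b} → a < b → ¬ (a ∷ a ∷ b ∷ [] ⊆ w)
Avoids122 w = ∀ {a b} → a < b → ¬ (a ∷ b ∷ b ∷ [] ⊆ w)

avoids112⇔ : ∀ w → T (avoids w (1 ∷ 1 ∷ 2 ∷ [])) ⇔ Avoids112 w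
avoids112⇔ w =
  mk⇔ (λ avoid {_} {_} a<b aab⊆w → avoids⁻ _ avoid aab⊆w (standardize-aab a<b)) (avoids⁺ w _ ∘ free)
  where
  free : Avoids112 w → ∀ {u} → u ⊆ w → standardize u ≢ 1 ∷ 1 ∷ 2 ∷ []
  free avoid u⊆w std with _ , _ , a<b , refl ← standardize≡112 _ std = avoid a<b u⊆w

avoids122⇔ : ∀ w → T (avoids w (1 ∷ 2 ∷ 2 ∷ [])) ⇔ Avoids122 w
avoids122⇔ w =
  mk⇔ (λ avoid {_} {_} a<b abb⊆w → avoids⁻ _ avoid abb⊆w (standardize-abb a<b)) (avoids⁺ w _ ∘ free)
  where
  free : Avoids122 w → ∀ {u} → u ⊆ w → standardize u ≢ 1 ∷ 2 ∷ 2 ∷ []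
  free avoid u⊆w std with _ , _ , a<b , refl ← standardize≡122 _ std = avoid a<b u⊆w

-- Restricted growth functions

rgfCheck-∷⁻ : ∀ m x xs → T (rgfCheck m (x ∷ xs)) → 1 ≤ x × x ≤ suc m × T (rgfCheck (m ⊔ x) xs)
rgfCheck-∷⁻ m x xs rgf
  with 1≤ᵇx , rest ← Equivalence.to T-∧ rgf
  with x≤ᵇ1+m , rgf′ ← Equivalence.to T-∧ rest =
  ≤ᵇ⇒≤ 1 x 1≤ᵇx , ≤ᵇ⇒≤ x (suc m) x≤ᵇ1+m , rgf′

rgfCheck-∷⁺ : ∀ m x xs → 1 ≤ x → x ≤ suc m → T (rgfCheck (m ⊔ x) xs) → T (rgfCheck m (x ∷ xs))
rgfCheck-∷⁺ m x xs 1≤x x≤1+m rgf′ =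
  Equivalence.from T-∧ (≤⇒≤ᵇ 1≤x , Equivalence.from T-∧ (≤⇒≤ᵇ x≤1+m , rgf′))

rgfCheck-subst : ∀ {m m′} ys → m ≡ m′ → T (rgfCheck m′ ys) → T (rgfCheck m ys)
rgfCheck-subst ys refl rgf = rgf

rgfCheck-old⁺ : ∀ {m x} xs → 1 ≤ x → x ≤ m → T (rgfCheck m xs) → T (rgfCheck m (x ∷ xs))
rgfCheck-old⁺ {m} {x} xs 1≤x x≤m rgf =
  rgfCheck-∷⁺ m x xs 1≤x (m≤n⇒m≤1+n x≤m) (rgfCheck-subst xs (m≥n⇒m⊔n≡m x≤m) rgf)

rgfCheck-new⁺ : ∀ {m} xs → T (rgfCheck (suc m) xs) → T (rgfCheck m (suc m ∷ xs))
rgfCheck-new⁺ {m} xs rgf =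
  rgfCheck-∷⁺ m (suc m) xs (s≤s z≤n) ≤-refl (rgfCheck-subst xs (m≤n⇒m⊔n≡n (n≤1+n m)) rgf)

rgfCheck-letters : ∀ m w → T (rgfCheck m w) → All (λ z → 1 ≤ z × z ≤ m + length w) w
rgfCheck-letters m []       _   = All.[]
rgfCheck-letters m (x ∷ xs) rgf with 1≤x , x≤1+m , rgf′ ← rgfCheck-∷⁻ m x xs rgf =
  (1≤x , first) All.∷ All.map (λ (1≤z , z≤) → 1≤z , ≤-trans z≤ rest) (rgfCheck-letters (m ⊔ x) xs rgf′)
  where
  bound : suc m + length xs ≡ m + suc (length xs)
  bound = sym (+-suc m (length xs))
  first : x ≤ m + suc (length xs)
  first = subst (x ≤_) bound (≤-trans x≤1+m (m≤m+n (suc m) _))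
  rest : (m ⊔ x) + length xs ≤ m + suc (length xs)
  rest = subst (m ⊔ x + length xs ≤_) bound (+-monoˡ-≤ (length xs) (⊔-lub (n≤1+n m) x≤1+m))

concatMap-map : ∀ {A B C : Set} (f : A → B → C) xs ys →
  concatMap (λ x → map (f x) ys) xs ≡ cartesianProductWith f xs ys
concatMap-map f []       ys = refl
concatMap-map f (x ∷ xs) ys = cong (map (f x) ys ++_) (concatMap-map f xs ys)

∈-words⁻ : ∀ n k {w} → w ∈ words n k → length w ≡ n
∈-words⁻ zero    k (here refl) = refl
∈-words⁻ (suc n) k w∈
  with _ , v , _ , v∈ , refl ← ∈-cartesianProductWith⁻ _∷_ (map suc (upTo k)) (words n k)
         (subst (_ ∈_) (concatMap-map _∷_ (map suc (upTo k)) (words n k)) w∈)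
  = cong suc (∈-words⁻ n k v∈)

∈-words⁺ : ∀ k w → All (λ z → 1 ≤ z × z ≤ k) w → w ∈ words (length w) k
∈-words⁺ k []       _ = here refl
∈-words⁺ k (zero ∷ xs)  ((() , _) All.∷ _)
∈-words⁺ k (suc x ∷ xs) ((_ , x<k) All.∷ letters) =
  subst (_ ∈_) (sym (concatMap-map _∷_ (map suc (upTo k)) (words (length xs) k)))
    (∈-cartesianProductWith⁺ _∷_ (∈-map⁺ suc (∈-upTo⁺ x<k)) (∈-words⁺ k xs letters))

words-unique : ∀ n k → Unique (words n k)
words-unique zero    k = All.[] AllPairs.∷ AllPairs.[]
words-unique (suc n) k = subst Unique (sym (concatMap-map _∷_ (map suc (upTo k)) (words n k)))
  (Unique.cartesianProductWith⁺ _∷_ ∷-injective (Unique.map⁺ suc-injective (Unique.upTo⁺ k)) (words-unique n k))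

∈-Rav⁻ : ∀ n v {w} → w ∈ Rav n v → length w ≡ n × T (isRGF w) × T (avoids w v)
∈-Rav⁻ n v w∈
  with w∈R , avoid ← ∈-filter⁻ (T? ∘ λ w → avoids w v) w∈
  with w∈words , rgf ← ∈-filter⁻ (T? ∘ isRGF) w∈R =
  ∈-words⁻ n n w∈words , rgf , avoid

∈-Rav⁺ : ∀ v {w} → T (isRGF w) → T (avoids w v) → w ∈ Rav (length w) v
∈-Rav⁺ v {w} rgf avoid =
  ∈-filter⁺ (T? ∘ λ w → avoids w v)
    (∈-filter⁺ (T? ∘ isRGF) (∈-words⁺ (length w) w (rgfCheck-letters 0 w rgf)) rgf) avoid

Rav-unique : ∀ n v → Unique (Rav n v)
Rav-unique n v = Unique.filter⁺ (T? ∘ λ w → avoids w v) (Unique.filter⁺ (T? ∘ isRGF) (words-unique n n))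

-- Encoding the avoiders by words over {old, new}

data Step : Set where
  old new : Step

news : List Step → ℕ
news []        = 0
news (old ∷ t) = news t
news (new ∷ t) = suc (news t)

descending : ℕ → List Step → Word
descending l []        = []
descending l (old ∷ t) = l ∷ descending l t
descending l (new ∷ t) = descending (pred l) t

onesAndMaxima : ℕ → List Step → Word
onesAndMaxima c []        = []
onesAndMaxima c (old ∷ t) = 1 ∷ onesAndMaxima c t
onesAndMaxima c (new ∷ t) = suc c ∷ onesAndMaxima (suc c) t

avoider112 avoider122 : List Step → Word
avoider112 t = interval 1 (suc (news t)) ++ descending (suc (news t)) t
avoider122 t = 1 ∷ onesAndMaxima 1 t

steps : ℕ → List (List Step)
steps zero    = [] ∷ []
steps (suc n) = cartesianProductWith _∷_ (old ∷ new ∷ []) (steps n)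

∈-descending⁻ : ∀ l t {z} → z ∈ descending l t → z ≤ l
∈-descending⁻ l (old ∷ t) (here refl) = ≤-refl
∈-descending⁻ l (old ∷ t) (there z∈) = ∈-descending⁻ l t z∈
∈-descending⁻ l (new ∷ t) z∈         = ≤-trans (∈-descending⁻ (pred l) t z∈) pred[n]≤n

∈-onesAndMaxima⁻ : ∀ c t {z} → z ∈ onesAndMaxima c t → z ≡ 1 ⊎ (c < z × z ≤ c + news t)
∈-onesAndMaxima⁻ c (old ∷ t) (here refl) = inj₁ refl
∈-onesAndMaxima⁻ c (old ∷ t) (there z∈)  = ∈-onesAndMaxima⁻ c t z∈
∈-onesAndMaxima⁻ c (new ∷ t) (here refl) =
  inj₂ (≤-refl , subst (suc c ≤_) (sym (+-suc c (news t))) (s≤s (m≤m+n c _)))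
∈-onesAndMaxima⁻ c (new ∷ t) {z} (there z∈) with ∈-onesAndMaxima⁻ (suc c) t z∈
... | inj₁ z≡1 = inj₁ z≡1
... | inj₂ (c<z , z≤) = inj₂ (<⇒≤ c<z , subst (z ≤_) (sym (+-suc c (news t))) z≤)

∈-onesAndMaxima⁺ : ∀ c t {z} → c < z → z ≤ c + news t → z ∈ onesAndMaxima c t
∈-onesAndMaxima⁺ c []        {z} c<z z≤c+0 = ⊥-elim (<⇒≱ c<z (subst (z ≤_) (+-identityʳ c) z≤c+0))
∈-onesAndMaxima⁺ c (old ∷ t) c<z z≤ = there (∈-onesAndMaxima⁺ c t c<z z≤)
∈-onesAndMaxima⁺ c (new ∷ t) {z} c<z z≤ with suc c ≟ z
... | yes refl = here refl
... | no  1+c≢z = there (∈-onesAndMaxima⁺ (suc c) t (≤∧≢⇒< c<z 1+c≢z) (subst (z ≤_) (+-suc c (news t)) z≤))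

-- Statistics of the encoded words

LettersBelow : ℕ → Word → Set
LettersBelow b pre = ∀ {z} → z ∈ pre ⇔ (1 ≤ z × z < b)

lettersBelow-[] : LettersBelow 1 []
lettersBelow-[] = mk⇔ (λ ()) (λ { (1≤z , z<1) → ⊥-elim (<⇒≱ z<1 1≤z) })

lettersBelow-new : ∀ {b pre} → 1 ≤ b → LettersBelow b pre → LettersBelow (suc b) (b ∷ pre)
lettersBelow-new {b} 1≤b letters = mk⇔ to from
  where
  to : ∀ {z} → z ∈ b ∷ _ → 1 ≤ z × z < suc b
  to (here refl) = 1≤b , ≤-refl
  to (there z∈)  = let 1≤z , z<b = Equivalence.to letters z∈ in 1≤z , m<n⇒m<1+n z<b
  from : ∀ {z} → 1 ≤ z × z < suc b → z ∈ b ∷ _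
  from {z} (1≤z , z<1+b) with z ≟ b
  ... | yes refl = here refl
  ... | no  z≢b  = there (Equivalence.from letters (1≤z , ≤∧≢⇒< (s≤s⁻¹ z<1+b) z≢b))

lettersBelow-old : ∀ {b pre x} → 1 ≤ x → x < b → LettersBelow b pre → LettersBelow b (x ∷ pre)
lettersBelow-old 1≤x x<b letters = mk⇔ (λ { (here refl) → 1≤x , x<b ; (there z∈) → Equivalence.to letters z∈ })
                                        (there ∘ Equivalence.from letters)

lettersBelow-interval : ∀ {c pre} j → 1 ≤ c → LettersBelow c pre → LettersBelow (c + j) (interval c j ʳ++ pre)
lettersBelow-interval {c} {pre} zero    _   letters = subst (λ b → LettersBelow b pre) (sym (+-identityʳ c)) letters
lettersBelow-interval {c} {pre} (suc j) 1≤c letters =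
  subst (λ b → LettersBelow b (interval (suc c) j ʳ++ c ∷ pre)) (sym (+-suc c j))
  (lettersBelow-interval j (s≤s z≤n) (lettersBelow-new 1≤c letters))

count-greater : ∀ {pre m} x k → x + k ≡ m → LettersBelow (suc m) pre → distinctCount (x <ᵇ_) pre ≡ k
count-greater {pre} x k refl letters = distinctCount-interval _ pre (suc x) k
  (λ z∈ x<z → let _ , z<1+x+k = Equivalence.to letters z∈ in <ᵇ⇒< x _ x<z , z<1+x+k)
  (λ {z} x<z z<1+x+k → Equivalence.from letters (≤-trans (s≤s z≤n) x<z , z<1+x+k) , <⇒<ᵇ x<z)

count-greater-none : ∀ {pre b} x → b ≤ suc x → LettersBelow b pre → distinctCount (x <ᵇ_) pre ≡ 0
count-greater-none {pre} x b≤1+x letters = distinctCount-none _ pre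
  (λ z∈ x<z → let _ , z<b = Equivalence.to letters z∈ in <⇒≱ (<-≤-trans z<b b≤1+x) (<ᵇ⇒< x _ x<z))

count-smaller : ∀ {pre b} a → suc a ≤ b → LettersBelow b pre → distinctCount (_<ᵇ suc a) pre ≡ a
count-smaller {pre} a 1+a≤b letters = distinctCount-interval _ pre 1 a
  (λ z∈ z<1+a → proj₁ (Equivalence.to letters z∈) , <ᵇ⇒< _ (suc a) z<1+a)
  (λ 1≤z z<1+a → Equivalence.from letters (1≤z , <-≤-trans z<1+a 1+a≤b) , <⇒<ᵇ z<1+a)

lbAt lsAt rbAt : Word → ℕ → Word → ℕ
lbAt pre x post = distinctCount (x <ᵇ_) pre
lsAt pre x post = distinctCount (_<ᵇ x) pre
rbAt pre x post = distinctCount (x <ᵇ_) post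

statGo-++ : ∀ f → (∀ pre x post post′ → f pre x post ≡ f pre x post′) → ∀ pre xs ys →
  statGo f pre (xs ++ ys) ≡ statGo f pre xs + statGo f (xs ʳ++ pre) ys
statGo-++ f blind pre []       ys = refl
statGo-++ f blind pre (x ∷ xs) ys = begin
  f pre x (xs ++ ys) + statGo f (x ∷ pre) (xs ++ ys)
    ≡⟨ cong₂ _+_ (blind pre x _ xs) (statGo-++ f blind (x ∷ pre) xs ys) ⟩
  f pre x xs + (statGo f (x ∷ pre) xs + statGo f (xs ʳ++ x ∷ pre) ys)
    ≡⟨ +-assoc (f pre x xs) _ _ ⟨
  f pre x xs + statGo f (x ∷ pre) xs + statGo f (xs ʳ++ x ∷ pre) ys ∎
  where open ≡-Reasoning

newsBeforeOlds : ℕ → List Step → ℕ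
newsBeforeOlds k []        = 0
newsBeforeOlds k (old ∷ t) = k + newsBeforeOlds k t
newsBeforeOlds k (new ∷ t) = newsBeforeOlds (suc k) t

newsAfterOlds : List Step → ℕ
newsAfterOlds []        = 0
newsAfterOlds (old ∷ t) = news t + newsAfterOlds t
newsAfterOlds (new ∷ t) = newsAfterOlds t

newsAfter : List Step → ℕ
newsAfter []      = 0
newsAfter (_ ∷ t) = news t + newsAfter t

sumFrom : ℕ → ℕ → ℕ
sumFrom a zero    = 0
sumFrom a (suc j) = a + sumFrom (suc a) j

sumFrom-suc : ∀ a j → sumFrom (suc a) j ≡ j + sumFrom a j
sumFrom-suc a zero    = refl
sumFrom-suc a (suc j) = cong suc (trans (cong (a +_) (sumFrom-suc (suc a) j)) (x∙yz≈y∙xz a j _))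

newsAfter-split : ∀ t → newsAfter t ≡ newsAfterOlds t + sumFrom 0 (news t)
newsAfter-split []        = refl
newsAfter-split (old ∷ t) = trans (cong (news t +_) (newsAfter-split t)) (sym (+-assoc (news t) _ _))
newsAfter-split (new ∷ t) = begin
  news t + newsAfter t                                  ≡⟨ cong (news t +_) (newsAfter-split t) ⟩
  news t + (newsAfterOlds t + sumFrom 0 (news t))       ≡⟨ x∙yz≈y∙xz (news t) (newsAfterOlds t) _ ⟩
  newsAfterOlds t + (news t + sumFrom 0 (news t))       ≡⟨ cong (newsAfterOlds t +_) (sumFrom-suc 0 (news t)) ⟨
  newsAfterOlds t + sumFrom 1 (news t)                  ∎
  where open ≡-Reasoning

lb-interval : ∀ {c pre} j → 1 ≤ c → LettersBelow c pre → statGo lbAt pre (interval c j) ≡ 0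
lb-interval zero    _ _ = refl
lb-interval {c} (suc j) 1≤c letters =
  cong₂ _+_ (count-greater-none c (n≤1+n c) letters) (lb-interval j (s≤s z≤n) (lettersBelow-new 1≤c letters))

ls-interval : ∀ {pre} a j → LettersBelow (suc a) pre → statGo lsAt pre (interval (suc a) j) ≡ sumFrom a j
ls-interval a zero    _ = refl
ls-interval a (suc j) letters =
  cong₂ _+_ (count-smaller a ≤-refl letters) (ls-interval (suc a) j (lettersBelow-new (s≤s z≤n) letters))

rb-interval-++ : ∀ {pre} c j E → (∀ {z} → z ∈ E → z < c + j) →
  statGo rbAt pre (interval c j ++ E) ≡ sumFrom 0 j + statGo rbAt (interval c j ʳ++ pre) E
rb-interval-++ c zero    E _ = refl
rb-interval-++ {pre} c (suc j) E E<c+j = begin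
  distinctCount (c <ᵇ_) (interval (suc c) j ++ E) + statGo rbAt (c ∷ pre) (interval (suc c) j ++ E)
    ≡⟨ cong₂ _+_ above-c (rb-interval-++ (suc c) j E (λ {z} z∈ → subst (z <_) (+-suc c j) (E<c+j z∈))) ⟩
  j + (sumFrom 0 j + X)   ≡⟨ +-assoc j _ X ⟨
  j + sumFrom 0 j + X     ≡⟨ cong (_+ X) (sumFrom-suc 0 j) ⟨
  sumFrom 1 j + X         ∎
  where
  open ≡-Reasoning
  X : ℕ
  X = statGo rbAt (interval (suc c) j ʳ++ c ∷ pre) E
  below-top : ∀ {z} → z ∈ interval (suc c) j ++ E → z < suc c + j
  below-top {z} z∈ with ∈-++⁻ (interval (suc c) j) z∈
  ... | inj₁ z∈interval = proj₂ (∈-interval⁻ (suc c) j z∈interval)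
  ... | inj₂ z∈E        = subst (z <_) (+-suc c j) (E<c+j z∈E)
  above-c : distinctCount (c <ᵇ_) (interval (suc c) j ++ E) ≡ j
  above-c = distinctCount-interval _ _ (suc c) j
    (λ z∈ c<z → <ᵇ⇒< c _ c<z , below-top z∈)
    (λ 1+c≤z z< → ∈-++⁺ˡ (∈-interval⁺ (suc c) j 1+c≤z z<) , <⇒<ᵇ 1+c≤z)

lb-descending : ∀ {pre m} t l k → news t < l → l + k ≡ m → LettersBelow (suc m) pre →
  statGo lbAt pre (descending l t) ≡ newsBeforeOlds k t
lb-descending []        l k _   _     _       = refl
lb-descending (old ∷ t) l k n<l l+k≡m letters =
  cong₂ _+_ (count-greater l k l+k≡m letters)
            (lb-descending t l k n<l l+k≡m (lettersBelow-old 1≤l (s≤s (subst (l ≤_) l+k≡m (m≤m+n l k))) letters))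
  where
  1≤l : 1 ≤ l
  1≤l = ≤-trans (s≤s z≤n) n<l
lb-descending (new ∷ t) (suc l) k n<l l+k≡m letters =
  lb-descending t l (suc k) (s≤s⁻¹ n<l) (trans (+-suc l k) l+k≡m) letters

ls-descending : ∀ {pre m} t → suc (news t) ≤ m → LettersBelow (suc m) pre →
  statGo lsAt pre (descending (suc (news t)) t) ≡ newsAfterOlds t
ls-descending []        _ _       = refl
ls-descending (old ∷ t) l≤m letters =
  cong₂ _+_ (count-smaller (news t) (m≤n⇒m≤1+n l≤m) letters)
            (ls-descending t l≤m (lettersBelow-old (s≤s z≤n) (s≤s l≤m) letters))
ls-descending (new ∷ t) l≤m letters = ls-descending t (<⇒≤ l≤m) letters

rb-descending : ∀ {pre} l t → statGo rbAt pre (descending l t) ≡ 0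
rb-descending l []        = refl
rb-descending l (old ∷ t) =
  cong₂ _+_ (distinctCount-none _ (descending l t) λ z∈ l<z → ≤⇒≯ (∈-descending⁻ l t z∈) (<ᵇ⇒< l _ l<z))
            (rb-descending l t)
rb-descending l (new ∷ t) = rb-descending (pred l) t

count-greater-maxima : ∀ c x t → 1 ≤ x → x ≤ c → distinctCount (x <ᵇ_) (onesAndMaxima c t) ≡ news t
count-greater-maxima c x t 1≤x x≤c = distinctCount-interval _ _ (suc c) (news t) sound
  (λ c<z z<1+c+n → ∈-onesAndMaxima⁺ c t c<z (s≤s⁻¹ z<1+c+n) , <⇒<ᵇ (≤-<-trans x≤c c<z))
  where
  sound : ∀ {z} → z ∈ onesAndMaxima c t → T (x <ᵇ z) → suc c ≤ z × z < suc c + news t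
  sound z∈ x<z with ∈-onesAndMaxima⁻ c t z∈
  ... | inj₁ refl         = ⊥-elim (<⇒≱ (<ᵇ⇒< x 1 x<z) 1≤x)
  ... | inj₂ (c<z , z≤)   = c<z , s≤s z≤

lb-onesAndMaxima : ∀ {pre} k t → LettersBelow (suc (suc k)) pre →
  statGo lbAt pre (onesAndMaxima (suc k) t) ≡ newsBeforeOlds k t
lb-onesAndMaxima k []        _       = refl
lb-onesAndMaxima k (old ∷ t) letters =
  cong₂ _+_ (count-greater 1 k refl letters)
            (lb-onesAndMaxima k t (lettersBelow-old (s≤s z≤n) (s≤s (s≤s z≤n)) letters))
lb-onesAndMaxima k (new ∷ t) letters =
  cong₂ _+_ (count-greater-none (suc (suc k)) (n≤1+n _) letters)
            (lb-onesAndMaxima (suc k) t (lettersBelow-new (s≤s z≤n) letters))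

ls-onesAndMaxima : ∀ {pre} c t → 1 ≤ c → LettersBelow (suc c) pre →
  statGo lsAt pre (onesAndMaxima c t) ≡ sumFrom c (news t)
ls-onesAndMaxima c []        _   _       = refl
ls-onesAndMaxima c (old ∷ t) 1≤c letters =
  cong₂ _+_ (count-smaller 0 (s≤s z≤n) letters)
            (ls-onesAndMaxima c t 1≤c (lettersBelow-old (s≤s z≤n) (s≤s 1≤c) letters))
ls-onesAndMaxima c (new ∷ t) 1≤c letters =
  cong₂ _+_ (count-smaller c ≤-refl letters)
            (ls-onesAndMaxima (suc c) t (s≤s z≤n) (lettersBelow-new (s≤s z≤n) letters))

rb-onesAndMaxima : ∀ {pre} c t → 1 ≤ c → statGo rbAt pre (onesAndMaxima c t) ≡ newsAfter t
rb-onesAndMaxima c []        _   = refl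
rb-onesAndMaxima c (old ∷ t) 1≤c =
  cong₂ _+_ (count-greater-maxima c 1 t ≤-refl 1≤c) (rb-onesAndMaxima c t 1≤c)
rb-onesAndMaxima c (new ∷ t) 1≤c =
  cong₂ _+_ (count-greater-maxima (suc c) (suc c) t (s≤s z≤n) ≤-refl) (rb-onesAndMaxima (suc c) t (s≤s z≤n))

module _ (t : List Step) where
  private
    m : ℕ
    m = news t
    prefix : Word
    prefix = interval 1 (suc m)
    letters : LettersBelow (suc (suc m)) (prefix ʳ++ [])
    letters = lettersBelow-interval (suc m) ≤-refl lettersBelow-[]
    letters-1 : LettersBelow 2 (1 ∷ [])
    letters-1 = lettersBelow-new ≤-refl lettersBelow-[]

  lb-avoiders : lb (avoider112 t) ≡ lb (avoider122 t)
  lb-avoiders = begin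
    lb (avoider112 t)
      ≡⟨ statGo-++ lbAt (λ _ _ _ _ → refl) [] prefix _ ⟩
    statGo lbAt [] prefix + statGo lbAt (prefix ʳ++ []) (descending (suc m) t)
      ≡⟨ cong₂ _+_ (lb-interval (suc m) ≤-refl lettersBelow-[])
                   (lb-descending t (suc m) 0 ≤-refl (+-identityʳ _) letters) ⟩
    newsBeforeOlds 0 t
      ≡⟨ lb-onesAndMaxima 0 t letters-1 ⟨
    lb (avoider122 t) ∎
    where open ≡-Reasoning

  ls≡rb-avoiders : ls (avoider112 t) ≡ rb (avoider122 t)
  ls≡rb-avoiders = begin
    ls (avoider112 t)
      ≡⟨ statGo-++ lsAt (λ _ _ _ _ → refl) [] prefix _ ⟩
    statGo lsAt [] prefix + statGo lsAt (prefix ʳ++ []) (descending (suc m) t)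
      ≡⟨ cong₂ _+_ (ls-interval 0 (suc m) lettersBelow-[]) (ls-descending t ≤-refl letters) ⟩
    sumFrom 1 m + newsAfterOlds t              ≡⟨ cong (_+ newsAfterOlds t) (sumFrom-suc 0 m) ⟩
    m + sumFrom 0 m + newsAfterOlds t          ≡⟨ +-assoc m _ _ ⟩
    m + (sumFrom 0 m + newsAfterOlds t)        ≡⟨ cong (m +_) (+-comm _ (newsAfterOlds t)) ⟩
    m + (newsAfterOlds t + sumFrom 0 m)        ≡⟨ cong (m +_) (newsAfter-split t) ⟨
    m + newsAfter t
      ≡⟨ cong₂ _+_ (count-greater-maxima 1 1 t ≤-refl ≤-refl) (rb-onesAndMaxima 1 t ≤-refl) ⟨
    rb (avoider122 t) ∎
    where open ≡-Reasoning

  rb≡ls-avoiders : rb (avoider112 t) ≡ ls (avoider122 t)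
  rb≡ls-avoiders = begin
    rb (avoider112 t)
      ≡⟨ rb-interval-++ 1 (suc m) _ (λ z∈ → s≤s (∈-descending⁻ (suc m) t z∈)) ⟩
    sumFrom 1 m + statGo rbAt (prefix ʳ++ []) (descending (suc m) t)
      ≡⟨ cong (sumFrom 1 m +_) (rb-descending (suc m) t) ⟩
    sumFrom 1 m + 0                              ≡⟨ +-identityʳ _ ⟩
    sumFrom 1 m                                  ≡⟨ ls-onesAndMaxima 1 t ≤-refl letters-1 ⟨
    ls (avoider122 t) ∎
    where open ≡-Reasoning

-- The encoded words are exactly the avoiders

length-descending : ∀ l t → length (descending l t) + news t ≡ length t
length-descending l []        = refl
length-descending l (old ∷ t) = cong suc (length-descending l t)
length-descending l (new ∷ t) = trans (+-suc _ (news t)) (cong suc (length-descending (pred l) t))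

length-avoider112 : ∀ t → length (avoider112 t) ≡ suc (length t)
length-avoider112 t = begin
  length (interval 1 (suc m) ++ descending (suc m) t)   ≡⟨ length-++ (interval 1 (suc m)) ⟩
  length (interval 1 (suc m)) + length (descending (suc m) t)
    ≡⟨ cong (_+ length (descending (suc m) t)) (length-interval 1 (suc m)) ⟩
  suc (m + length (descending (suc m) t))               ≡⟨ cong suc (+-comm m _) ⟩
  suc (length (descending (suc m) t) + m)               ≡⟨ cong suc (length-descending (suc m) t) ⟩
  suc (length t)                                        ∎
  where
  open ≡-Reasoning
  m : ℕ
  m = news t

length-onesAndMaxima : ∀ c t → length (onesAndMaxima c t) ≡ length t
length-onesAndMaxima c []        = refl
length-onesAndMaxima c (old ∷ t) = cong suc (length-onesAndMaxima c t)
length-onesAndMaxima c (new ∷ t) = cong suc (length-onesAndMaxima (suc c) t)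

rgfCheck-interval-++ : ∀ k j ys → T (rgfCheck (k + j) ys) → T (rgfCheck k (interval (suc k) j ++ ys))
rgfCheck-interval-++ k zero    ys rgf = rgfCheck-subst ys (sym (+-identityʳ k)) rgf
rgfCheck-interval-++ k (suc j) ys rgf =
  rgfCheck-new⁺ (interval (suc (suc k)) j ++ ys) (rgfCheck-interval-++ (suc k) j ys (rgfCheck-subst ys (sym (+-suc k j)) rgf))

rgfCheck-bounded : ∀ m ys → All (λ z → 1 ≤ z × z ≤ m) ys → T (rgfCheck m ys)
rgfCheck-bounded m []       _ = _
rgfCheck-bounded m (x ∷ ys) ((1≤x , x≤m) All.∷ letters) = rgfCheck-old⁺ ys 1≤x x≤m (rgfCheck-bounded m ys letters)

descending-positive : ∀ l t {z} → news t < l → z ∈ descending l t → 1 ≤ z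
descending-positive l       (old ∷ t) n<l (here refl) = ≤-trans (s≤s z≤n) n<l
descending-positive l       (old ∷ t) n<l (there z∈)  = descending-positive l t n<l z∈
descending-positive (suc l) (new ∷ t) n<l z∈          = descending-positive l t (s≤s⁻¹ n<l) z∈

isRGF-avoider112 : ∀ t → T (isRGF (avoider112 t))
isRGF-avoider112 t = rgfCheck-interval-++ 0 (suc (news t)) _ (rgfCheck-bounded _ _
  (All.tabulate (λ z∈ → descending-positive _ t ≤-refl z∈ , ∈-descending⁻ _ t z∈)))

rgfCheck-onesAndMaxima : ∀ c t → 1 ≤ c → T (rgfCheck c (onesAndMaxima c t))
rgfCheck-onesAndMaxima c []        _   = _
rgfCheck-onesAndMaxima c (old ∷ t) 1≤c =
  rgfCheck-old⁺ (onesAndMaxima c t) ≤-refl 1≤c (rgfCheck-onesAndMaxima c t 1≤c)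
rgfCheck-onesAndMaxima c (new ∷ t) 1≤c =
  rgfCheck-new⁺ (onesAndMaxima (suc c) t) (rgfCheck-onesAndMaxima (suc c) t (s≤s z≤n))

isRGF-avoider122 : ∀ t → T (isRGF (avoider122 t))
isRGF-avoider122 t = rgfCheck-onesAndMaxima 1 t ≤-refl

WeaklyDecreasing : Word → Set
WeaklyDecreasing w = ∀ {x y} → x ∷ y ∷ [] ⊆ w → y ≤ x

descending-weaklyDecreasing : ∀ l t → WeaklyDecreasing (descending l t)
descending-weaklyDecreasing l (old ∷ t) (.l ∷ʳ xy⊆) = descending-weaklyDecreasing l t xy⊆
descending-weaklyDecreasing l (old ∷ t) (refl ∷ y⊆) = ∈-descending⁻ l t (to∈ y⊆)
descending-weaklyDecreasing l (new ∷ t) xy⊆          = descending-weaklyDecreasing (pred l) t xy⊆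

ascent-after-interval : ∀ {D} → WeaklyDecreasing D → ∀ d j {x b} →
  x ∷ b ∷ [] ⊆ interval d j ++ D → x < d → x < b → ⊥
ascent-after-interval decreasing d zero    xb⊆           x<d x<b = <⇒≱ x<b (decreasing xb⊆)
ascent-after-interval decreasing d (suc j) (.d ∷ʳ xb⊆)   x<d x<b =
  ascent-after-interval decreasing (suc d) j xb⊆ (m<n⇒m<1+n x<d) x<b
ascent-after-interval decreasing d (suc j) (refl ∷ _)    x<d x<b = <-irrefl refl x<d

interval-++-avoids112 : ∀ {D} → WeaklyDecreasing D → ∀ c j → Avoids112 (interval c j ++ D)
interval-++-avoids112 decreasing c zero    a<b aab⊆         =
  <⇒≱ a<b (decreasing (⊆-trans (refl ∷ (_ ∷ʳ ⊆-refl)) aab⊆))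
interval-++-avoids112 decreasing c (suc j) a<b (.c ∷ʳ aab⊆)  = interval-++-avoids112 decreasing (suc c) j a<b aab⊆
interval-++-avoids112 decreasing c (suc j) a<b (refl ∷ ab⊆)  = ascent-after-interval decreasing (suc c) j ab⊆ ≤-refl a<b

onesAndMaxima-no-repeat : ∀ c t {b} → 1 ≤ c → 2 ≤ b → ¬ (b ∷ b ∷ [] ⊆ onesAndMaxima c t)
onesAndMaxima-no-repeat c (old ∷ t) 1≤c 2≤b (._ ∷ʳ bb⊆) = onesAndMaxima-no-repeat c t 1≤c 2≤b bb⊆
onesAndMaxima-no-repeat c (old ∷ t) 1≤c (s≤s ()) (refl ∷ _)
onesAndMaxima-no-repeat c (new ∷ t) 1≤c 2≤b (._ ∷ʳ bb⊆) = onesAndMaxima-no-repeat (suc c) t (s≤s z≤n) 2≤b bb⊆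
onesAndMaxima-no-repeat c (new ∷ t) 1≤c 2≤b (refl ∷ b⊆) with ∈-onesAndMaxima⁻ (suc c) t (to∈ b⊆)
... | inj₁ 1+c≡1     = <⇒≢ 1≤c (sym (suc-injective 1+c≡1))
... | inj₂ (c<c , _) = <-irrefl refl c<c

avoids122-avoider122 : ∀ t → Avoids122 (avoider122 t)
avoids122-avoider122 t {a} a<b abb⊆ = onesAndMaxima-no-repeat 1 t ≤-refl (≤-<-trans 1≤a a<b) (∷⁻ abb⊆)
  where
  1≤a : 1 ≤ a
  1≤a = proj₁ (All.lookup (rgfCheck-letters 0 _ (isRGF-avoider122 t)) (lookup abb⊆ (here refl)))

avoider112∈Rav : ∀ t → avoider112 t ∈ Rav (suc (length t)) (1 ∷ 1 ∷ 2 ∷ [])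
avoider112∈Rav t = subst (λ n → avoider112 t ∈ Rav n (1 ∷ 1 ∷ 2 ∷ [])) (length-avoider112 t)
  (∈-Rav⁺ _ (isRGF-avoider112 t) (Equivalence.from (avoids112⇔ _)
    (interval-++-avoids112 (descending-weaklyDecreasing (suc (news t)) t) 1 (suc (news t)))))

avoider122∈Rav : ∀ t → avoider122 t ∈ Rav (suc (length t)) (1 ∷ 2 ∷ 2 ∷ [])
avoider122∈Rav t = subst (λ n → avoider122 t ∈ Rav n (1 ∷ 2 ∷ 2 ∷ [])) (cong suc (length-onesAndMaxima 1 t))
  (∈-Rav⁺ _ (isRGF-avoider122 t) (Equivalence.from (avoids122⇔ _) (avoids122-avoider122 t)))

onesAndMaxima-injective : ∀ c {t t′} → 1 ≤ c → onesAndMaxima c t ≡ onesAndMaxima c t′ → t ≡ t′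
onesAndMaxima-injective c {[]}      {[]}       _   _  = refl
onesAndMaxima-injective c {[]}      {old ∷ _}  _   ()
onesAndMaxima-injective c {[]}      {new ∷ _}  _   ()
onesAndMaxima-injective c {old ∷ _} {[]}       _   ()
onesAndMaxima-injective c {new ∷ _} {[]}       _   ()
onesAndMaxima-injective c {old ∷ t} {old ∷ t′} 1≤c eq =
  cong (old ∷_) (onesAndMaxima-injective c 1≤c (∷-injectiveʳ eq))
onesAndMaxima-injective c {new ∷ t} {new ∷ t′} 1≤c eq =
  cong (new ∷_) (onesAndMaxima-injective (suc c) (s≤s z≤n) (∷-injectiveʳ eq))
onesAndMaxima-injective c {old ∷ t} {new ∷ t′} 1≤c eq =
  ⊥-elim (<⇒≢ 1≤c (suc-injective (∷-injectiveˡ eq)))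
onesAndMaxima-injective c {new ∷ t} {old ∷ t′} 1≤c eq =
  ⊥-elim (<⇒≢ 1≤c (sym (suc-injective (∷-injectiveˡ eq))))

avoider122-injective : ∀ {t t′} → avoider122 t ≡ avoider122 t′ → t ≡ t′
avoider122-injective eq = onesAndMaxima-injective 1 ≤-refl (∷-injectiveʳ eq)

interval-++-injectiveˡ : ∀ c i j {E E′} → interval c i ++ E ≡ interval c j ++ E′ →
  All (_< c + i) E → All (_< c + j) E′ → i ≡ j
interval-++-injectiveˡ c zero    zero    eq _ _ = refl
interval-++-injectiveˡ c zero    (suc j) refl E< _ = ⊥-elim (<-irrefl (sym (+-identityʳ c)) (All.head E<))
interval-++-injectiveˡ c (suc i) zero    refl _ E′< = ⊥-elim (<-irrefl (sym (+-identityʳ c)) (All.head E′<))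
interval-++-injectiveˡ c (suc i) (suc j) eq E< E′< = cong suc (interval-++-injectiveˡ (suc c) i j (∷-injectiveʳ eq)
  (All.map (λ {z} → subst (z <_) (+-suc c i)) E<) (All.map (λ {z} → subst (z <_) (+-suc c j)) E′<))

descending-injective : ∀ l {t t′} → news t < l → news t ≡ news t′ →
  descending l t ≡ descending l t′ → t ≡ t′
descending-injective zero    ()
descending-injective (suc l) {[]}      {[]}       _   _    _  = refl
descending-injective (suc l) {[]}      {old ∷ _}  _   _    ()
descending-injective (suc l) {old ∷ _} {[]}       _   _    ()
descending-injective (suc l) {old ∷ t} {old ∷ t′} n<l same eq =
  cong (old ∷_) (descending-injective (suc l) n<l same (∷-injectiveʳ eq))
descending-injective (suc l) {new ∷ t} {new ∷ t′} n<l same eq =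
  cong (new ∷_) (descending-injective l (s≤s⁻¹ n<l) (suc-injective same) eq)
descending-injective (suc l) {old ∷ t} {new ∷ t′} _   _    eq =
  ⊥-elim (1+n≰n (∈-descending⁻ l t′ (subst (suc l ∈_) eq (here refl))))
descending-injective (suc l) {new ∷ t} {old ∷ t′} _   _    eq =
  ⊥-elim (1+n≰n (∈-descending⁻ l t (subst (suc l ∈_) (sym eq) (here refl))))

avoider112-injective : ∀ {t t′} → avoider112 t ≡ avoider112 t′ → t ≡ t′
avoider112-injective {t} {t′} eq =
  descending-injective (suc (news t)) ≤-refl same-news (++-cancelˡ (interval 1 (suc (news t))) _ _ eq′)
  where
  bounded : ∀ t → All (_< suc (suc (news t))) (descending (suc (news t)) t)
  bounded t = All.tabulate (s≤s ∘ ∈-descending⁻ _ t)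
  same-news : news t ≡ news t′
  same-news = suc-injective (interval-++-injectiveˡ 1 _ _ eq (bounded t) (bounded t′))
  eq′ : interval 1 (suc (news t)) ++ descending (suc (news t)) t
      ≡ interval 1 (suc (news t)) ++ descending (suc (news t)) t′
  eq′ = trans eq (cong (λ m → interval 1 (suc m) ++ descending (suc m) t′) (sym same-news))

steps-length : ∀ n {t} → t ∈ steps n → length t ≡ n
steps-length zero    (here refl) = refl
steps-length (suc n) t∈
  with _ , t′ , _ , t′∈ , refl ← ∈-cartesianProductWith⁻ _∷_ (old ∷ new ∷ []) (steps n) t∈ =
  cong suc (steps-length n t′∈)

∈-steps : ∀ t → t ∈ steps (length t)
∈-steps []        = here refl
∈-steps (old ∷ t) = ∈-cartesianProductWith⁺ _∷_ {xs = old ∷ new ∷ []} (here refl) (∈-steps t)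
∈-steps (new ∷ t) = ∈-cartesianProductWith⁺ _∷_ {xs = old ∷ new ∷ []} (there (here refl)) (∈-steps t)

steps-unique : ∀ n → Unique (steps n)
steps-unique zero    = All.[] AllPairs.∷ AllPairs.[]
steps-unique (suc n) = Unique.cartesianProductWith⁺ _∷_ ∷-injective
  (((λ ()) All.∷ All.[]) AllPairs.∷ All.[] AllPairs.∷ AllPairs.[]) (steps-unique n)

isRGF-∷⁻ : ∀ {x ys} → T (isRGF (x ∷ ys)) → x ≡ 1 × T (rgfCheck 1 ys)
isRGF-∷⁻ {x} {ys} rgf
  with 1≤x , x≤1 , rgf′ ← rgfCheck-∷⁻ 0 x ys rgf
  with refl ← ≤-antisym x≤1 1≤x = refl , rgf′

DescendingFrom : ℕ → Word → Set
DescendingFrom l []       = ⊤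
DescendingFrom l (x ∷ ys) = 1 ≤ x × x ≤ l × DescendingFrom x ys

news-replicate-new : ∀ j u → news (replicate j new ++ u) ≡ j + news u
news-replicate-new zero    u = refl
news-replicate-new (suc j) u = cong suc (news-replicate-new j u)

descending-replicate-new : ∀ x j u → descending (x + j) (replicate j new ++ u) ≡ descending x u
descending-replicate-new x zero    u = cong (λ l → descending l u) (+-identityʳ x)
descending-replicate-new x (suc j) u = trans (cong (λ l → descending (pred l) (replicate j new ++ u)) (+-suc x j))
                                             (descending-replicate-new x j u)

descending-surjective : ∀ l ys → 1 ≤ l → DescendingFrom l ys → ∃[ t ] descending l t ≡ ys × suc (news t) ≡ l
descending-surjective (suc l) [] _ _ =
  replicate l new ++ [] , descending-replicate-new 1 l [] , cong suc (trans (news-replicate-new l []) (+-identityʳ l))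
descending-surjective l (x ∷ ys) _ (1≤x , x≤l , rest)
  with t , t↦ys , 1+news≡x ← descending-surjective x ys 1≤x rest
  with j , refl ← m≤n⇒∃[o]m+o≡n x≤l =
  replicate j new ++ old ∷ t , trans (descending-replicate-new x j (old ∷ t)) (cong (x ∷_) t↦ys) , news≡
  where
  open ≡-Reasoning
  news≡ : suc (news (replicate j new ++ old ∷ t)) ≡ x + j
  news≡ = begin
    suc (news (replicate j new ++ old ∷ t))  ≡⟨ cong suc (news-replicate-new j (old ∷ t)) ⟩
    suc (j + news t)                          ≡⟨ +-suc j (news t) ⟨
    j + suc (news t)                          ≡⟨ cong (j +_) 1+news≡x ⟩
    j + x                                     ≡⟨ +-comm j x ⟩
    x + j                                     ∎

NoAscentFrom : ℕ → Word → Set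
NoAscentFrom k w = ∀ {a b} → 1 ≤ a → a ≤ k → a < b → ¬ (a ∷ b ∷ [] ⊆ w)

noAscent⇒descendingFrom : ∀ k y ys → 1 ≤ y → y ≤ k → T (rgfCheck k ys) → NoAscentFrom k (y ∷ ys) →
  DescendingFrom y ys
noAscent⇒descendingFrom k y []       _   _   _   _         = _
noAscent⇒descendingFrom k y (z ∷ ys) 1≤y y≤k rgf noAscent
  with 1≤z , _ , rgf′ ← rgfCheck-∷⁻ k z ys rgf =
  1≤z , z≤y , noAscent⇒descendingFrom k z ys 1≤z (≤-trans z≤y y≤k)
                (rgfCheck-subst ys (sym (m≥n⇒m⊔n≡m (≤-trans z≤y y≤k))) rgf′)
                (λ 1≤a a≤k a<b ab⊆ → noAscent 1≤a a≤k a<b (y ∷ʳ ab⊆))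
  where
  z≤y : z ≤ y
  z≤y = ≮⇒≥ (λ y<z → noAscent 1≤y y≤k y<z (refl ∷ refl ∷ minimum ys))

avoider112-from-tail : ∀ k ys → 1 ≤ k → DescendingFrom k ys → ∃[ t ] avoider112 t ≡ interval 1 k ++ ys
avoider112-from-tail k ys 1≤k desc with t , t↦ys , refl ← descending-surjective k ys 1≤k desc =
  t , cong (interval 1 (suc (news t)) ++_) t↦ys

-- Extend the run 1, …, k while the next letter is k + 1.  After it no letter a ≤ k can be
-- followed by a larger one, since a already occurs in the run and a a b would be a 112.
avoider112-from-run : ∀ k ys → 1 ≤ k → T (rgfCheck k ys) → Avoids112 (interval 1 k ++ ys) →
  ∃[ t ] avoider112 t ≡ interval 1 k ++ ys
avoider112-from-run k []       1≤k _   _     = avoider112-from-tail k [] 1≤k _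
avoider112-from-run k (x ∷ ys) 1≤k rgf avoid with 1≤x , x≤1+k , rgf′ ← rgfCheck-∷⁻ k x ys rgf | x ≟ suc k
... | yes refl =
  let t , t↦ = avoider112-from-run (suc k) ys (s≤s z≤n) (rgfCheck-subst ys (sym (m≤n⇒m⊔n≡n (n≤1+n k))) rgf′)
                 (λ a<b aab⊆ → avoid a<b (subst (_ ⊆_) longer-run aab⊆))
  in t , trans t↦ longer-run
  where
  longer-run : interval 1 (suc k) ++ ys ≡ interval 1 k ++ suc k ∷ ys
  longer-run = trans (cong (_++ ys) (interval-suc 1 k)) (++-assoc (interval 1 k) [ suc k ] ys)
... | no  x≢1+k =
  avoider112-from-tail k (x ∷ ys) 1≤k (1≤x , x≤k , noAscent⇒descendingFrom k x ys 1≤x x≤k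
    (rgfCheck-subst ys (sym (m≥n⇒m⊔n≡m x≤k)) rgf′)
    λ 1≤a a≤k a<b ab⊆ → avoid a<b (⊆-++⁺ (from∈ (∈-interval⁺ 1 k 1≤a (s≤s a≤k))) ab⊆))
  where
  x≤k : x ≤ k
  x≤k = s≤s⁻¹ (≤∧≢⇒< x≤1+k x≢1+k)

avoider112-surjective : ∀ n {w} → w ∈ Rav (suc n) (1 ∷ 1 ∷ 2 ∷ []) → ∃[ t ] t ∈ steps n × avoider112 t ≡ w
avoider112-surjective n {[]}     w∈ = ⊥-elim (0≢1+n (proj₁ (∈-Rav⁻ (suc n) _ w∈)))
avoider112-surjective n {x ∷ ys} w∈
  with length≡ , rgf , avoid ← ∈-Rav⁻ (suc n) _ w∈
  with refl , rgf′ ← isRGF-∷⁻ {x} {ys} rgf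
  with t , t↦w ← avoider112-from-run 1 ys ≤-refl rgf′ (Equivalence.to (avoids112⇔ _) avoid) =
  t , subst (λ m → t ∈ steps m) length≡t (∈-steps t) , t↦w
  where
  length≡t : length t ≡ n
  length≡t = suc-injective (trans (sym (length-avoider112 t)) (trans (cong length t↦w) length≡))

-- The hypotheses say that 2, …, c are already used and that no letter b ≥ 2 repeats; together
-- with the growth condition they force every letter to be 1 or c + 1.
onesAndMaxima-surjective : ∀ c ys → 1 ≤ c → T (rgfCheck c ys) →
  (∀ {x} → 2 ≤ x → x ≤ c → ¬ x ∈ ys) → (∀ {b} → 2 ≤ b → ¬ (b ∷ b ∷ [] ⊆ ys)) →
  ∃[ t ] onesAndMaxima c t ≡ ys
onesAndMaxima-surjective c []       _   _   _    _      = [] , refl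
onesAndMaxima-surjective c (x ∷ ys) 1≤c rgf used repeat
  with 1≤x , x≤1+c , rgf′ ← rgfCheck-∷⁻ c x ys rgf | x ≟ 1 | x ≟ suc c
... | yes refl | _ =
  let t , t↦ys = onesAndMaxima-surjective c ys 1≤c (rgfCheck-subst ys (sym (m≥n⇒m⊔n≡m 1≤c)) rgf′)
                   (λ 2≤z z≤c z∈ → used 2≤z z≤c (there z∈)) (λ 2≤b bb⊆ → repeat 2≤b (1 ∷ʳ bb⊆))
  in old ∷ t , cong (1 ∷_) t↦ys
... | no x≢1 | yes refl =
  let t , t↦ys = onesAndMaxima-surjective (suc c) ys (s≤s z≤n)
                   (rgfCheck-subst ys (sym (m≤n⇒m⊔n≡n (n≤1+n c))) rgf′) used′
                   (λ 2≤b bb⊆ → repeat 2≤b (suc c ∷ʳ bb⊆))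
  in new ∷ t , cong (suc c ∷_) t↦ys
  where
  used′ : ∀ {z} → 2 ≤ z → z ≤ suc c → ¬ z ∈ ys
  used′ {z} 2≤z z≤1+c z∈ with z ≟ suc c
  ... | yes refl = repeat 2≤z (refl ∷ from∈ z∈)
  ... | no  z≢1+c = used 2≤z (s≤s⁻¹ (≤∧≢⇒< z≤1+c z≢1+c)) (there z∈)
... | no x≢1 | no x≢1+c =
  ⊥-elim (used (≤∧≢⇒< 1≤x (x≢1 ∘ sym)) (s≤s⁻¹ (≤∧≢⇒< x≤1+c x≢1+c)) (here refl))

avoider122-surjective : ∀ n {w} → w ∈ Rav (suc n) (1 ∷ 2 ∷ 2 ∷ []) → ∃[ t ] t ∈ steps n × avoider122 t ≡ w
avoider122-surjective n {[]}     w∈ = ⊥-elim (0≢1+n (proj₁ (∈-Rav⁻ (suc n) _ w∈)))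
avoider122-surjective n {x ∷ ys} w∈
  with length≡ , rgf , avoid ← ∈-Rav⁻ (suc n) _ w∈
  with refl , rgf′ ← isRGF-∷⁻ {x} {ys} rgf
  with t , t↦ys ← onesAndMaxima-surjective 1 ys ≤-refl rgf′ (λ 2≤x x≤1 _ → <⇒≱ 2≤x x≤1)
                    (λ 2≤b bb⊆ → Equivalence.to (avoids122⇔ _) avoid 2≤b (refl ∷ bb⊆)) =
  t , subst (λ m → t ∈ steps m) length≡t (∈-steps t) , cong (1 ∷_) t↦ys
  where
  length≡t : length t ≡ n
  length≡t = suc-injective
    (trans (cong suc (sym (length-onesAndMaxima 1 t))) (trans (cong (length ∘ (1 ∷_)) t↦ys) length≡))

↭-map-bijection : ∀ {A B : Set} (f : A → B) {xs : List A} {ys : List B} →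
  (∀ {a a′} → f a ≡ f a′ → a ≡ a′) → Unique xs → Unique ys →
  (∀ {a} → a ∈ xs → f a ∈ ys) → (∀ {b} → b ∈ ys → ∃[ a ] a ∈ xs × f a ≡ b) → ys ↭ map f xs
↭-map-bijection f {xs} {ys} injective xs-unique ys-unique into onto =
  ∼bag⇒↭ (unique∧set⇒bag ys-unique (Unique.map⁺ injective xs-unique) (mk⇔ to from))
  where
  to : ∀ {b} → b ∈ ys → b ∈ map f xs
  to b∈ with a , a∈ , refl ← onto b∈ = ∈-map⁺ f a∈
  from : ∀ {b} → b ∈ map f xs → b ∈ ys
  from b∈ with a , a∈ , refl ← ∈-map⁻ f b∈ = into a∈

Rav112↭avoiders : ∀ n → Rav (suc n) (1 ∷ 1 ∷ 2 ∷ []) ↭ map avoider112 (steps n)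
Rav112↭avoiders n = ↭-map-bijection avoider112 avoider112-injective (steps-unique n) (Rav-unique (suc n) _)
  (λ {t} t∈ → subst (λ m → avoider112 t ∈ Rav (suc m) _) (steps-length n t∈) (avoider112∈Rav t))
  (avoider112-surjective n)

Rav122↭avoiders : ∀ n → Rav (suc n) (1 ∷ 2 ∷ 2 ∷ []) ↭ map avoider122 (steps n)
Rav122↭avoiders n = ↭-map-bijection avoider122 avoider122-injective (steps-unique n) (Rav-unique (suc n) _)
  (λ {t} t∈ → subst (λ m → avoider122 t ∈ Rav (suc m) _) (steps-length n t∈) (avoider122∈Rav t))
  (avoider122-surjective n)

module _ {c ℓ : Level} (S : CommutativeSemiring c ℓ) where
  private
    module S = CommutativeSemiring S
  open CommutativeSemigroupProperties (CommutativeMonoid.commutativeSemigroup S.*-commutativeMonoid) using (xy∙z≈xz∙y)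

  weight : S.Carrier → S.Carrier → S.Carrier → S.Carrier → Word → S.Carrier
  weight q r s t w = pow S q (lb w) S.* pow S r (ls w) S.* pow S s (rb w) S.* pow S t (rs w)

  sumC-↭ : ∀ {xs ys} → xs ↭ ys → sumC S xs S.≈ sumC S ys
  sumC-↭ Perm.refl          = S.refl
  sumC-↭ (Perm.prep x p)    = S.+-congˡ (sumC-↭ p)
  sumC-↭ (Perm.swap x y p)  = S.trans (S.+-congˡ (S.+-congˡ (sumC-↭ p)))
    (S.trans (S.sym (S.+-assoc x y _)) (S.trans (S.+-congʳ (S.+-comm x y)) (S.+-assoc y x _)))
  sumC-↭ (Perm.trans p p′)  = S.trans (sumC-↭ p) (sumC-↭ p′)

  sumC-map-cong : ∀ {A : Set} {f g : A → S.Carrier} → (∀ a → f a S.≈ g a) → ∀ as →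
    sumC S (map f as) S.≈ sumC S (map g as)
  sumC-map-cong f≈g []       = S.refl
  sumC-map-cong f≈g (a ∷ as) = S.+-cong (f≈g a) (sumC-map-cong f≈g as)

  sumC-encoding : ∀ {A : Set} (f : Word → S.Carrier) (code : A → Word) {ws} as → ws ↭ map code as →
    sumC S (map f ws) S.≈ sumC S (map (f ∘ code) as)
  sumC-encoding f code as ws↭ = S.trans (sumC-↭ (↭-map⁺ f ws↭)) (S.reflexive (cong (sumC S) (sym (map-∘ as))))

  pow-1# : ∀ n → pow S S.1# n S.≈ S.1#
  pow-1# zero    = S.refl
  pow-1# (suc n) = S.trans (S.*-identityˡ _) (pow-1# n)

  weights-agree : ∀ q r s t → weight q r s S.1# (avoider112 t) S.≈ weight q s r S.1# (avoider122 t)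
  weights-agree q r s t
    rewrite lb-avoiders t | ls≡rb-avoiders t | rb≡ls-avoiders t =
    S.*-cong (xy∙z≈xz∙y _ _ _) (S.trans (pow-1# (rs (avoider112 t))) (S.sym (pow-1# (rs (avoider122 t)))))

theorem2p12 : {c ℓ : Level} (S : CommutativeSemiring c ℓ) (n : ℕ)
    (q r s : CommutativeSemiring.Carrier S) →
    CommutativeSemiring._≈_ S
    (F S n (1 ∷ 1 ∷ 2 ∷ []) q r s (CommutativeSemiring.1# S))
    (F S n (1 ∷ 2 ∷ 2 ∷ []) q s r (CommutativeSemiring.1# S))
theorem2p12 S zero    q r s = CommutativeSemiring.refl S
theorem2p12 S (suc n) q r s = begin
  F S (suc n) (1 ∷ 1 ∷ 2 ∷ []) q r s 1#                  ≈⟨ sumC-encoding S _ avoider112 (steps n) (Rav112↭avoiders n) ⟩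
  sumC S (map (weight S q r s 1# ∘ avoider112) (steps n))  ≈⟨ sumC-map-cong S (weights-agree S q r s) (steps n) ⟩
  sumC S (map (weight S q s r 1# ∘ avoider122) (steps n))  ≈⟨ sumC-encoding S _ avoider122 (steps n) (Rav122↭avoiders n) ⟨
  F S (suc n) (1 ∷ 2 ∷ 2 ∷ []) q s r 1#                  ∎
  where
  open CommutativeSemiring S using (1#; setoid)
  open import Relation.Binary.Reasoning.Setoid setoid
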